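{- For positive integers $n,k_1,\ldots,k_n$, we have \begin{align*} y\overset{t}{\sqcup\!\sqcup} z_{k_1}\cdots z_{k_n}=&\sum\limits_{i=0}^nz_{k_1}\cdots z_{k_i}z_1z_{k_{i+1}}\cdots z_{k_n} +\sum\limits_{i=1}^n\sum\limits_{j=2}^{k_i}z_{k_1}\cdots z_{k_{i-1}}z_jz_{k_i+1-j}z_{k_{i+1}}\cdots z_{k_n}\\ &-\sum\limits_{i=1}^{n}(k_i+\delta_{ni})tz_{k_1}\cdots z_{k_{i-1}}z_{k_i+1}z_{k_{i+1}}\cdots z_{k_n}, \end{align*} and \begin{align*} y\overset{t}{\ast} z_{k_1}\cdots z_{k_n}=&\sum\limits_{i=0}^nz_{k_1}\cdots z_{k_i}z_1z_{k_{i+1}}\cdots z_{k_n} +(1-2t)\sum\limits_{i=1}^nz_{k_1}\cdots z_{k_{i-1}}z_{k_i+1}z_{k_{i+1}}\cdots z_{k_n}\\ &+(t^2-t)\sum\limits_{i=1}^{n-1}z_{k_1}\cdots z_{k_{i-1}}z_{k_i+k_{i+1}+1}z_{k_{i+2}}\cdots z_{k_n}. \end{align*}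
   Context: Let $A=\{x,y\}$ be an alphabet of two noncommutative letters, $A^{\ast}$ the set of words (including the empty word $1$), $\mathfrak{h}_t=\mathbb{Q}[t]\langle A\rangle$, $\mathfrak{h}_t^1=\mathbb{Q}[t]+\mathfrak{h}_ty$, and $z_k=x^{k-1}y$ (so $z_1=y$). $\delta_{ij}$ is the Kronecker delta. The $t$-shuffle product $\overset{t}{\sqcup\!\sqcup}$ is the $\mathbb{Q}[t]$-bilinear product on $\mathfrak{h}_t$ with $1\overset{t}{\sqcup\!\sqcup} w=w\overset{t}{\sqcup\!\sqcup} 1=w$ and $aw_1\overset{t}{\sqcup\!\sqcup} bw_2=a(w_1\overset{t}{\sqcup\!\sqcup} bw_2)+b(aw_1\overset{t}{\sqcup\!\sqcup} w_2)-\delta(w_1)\rho(a)bw_2-\delta(w_2)\rho(b)aw_1$ for $w,w_1,w_2\in A^\ast$, $a,b\in A$, where $\delta(w)=1$ if $w=1$ and $0$ otherwise, and $\rho(x)=0$, $\rho(y)=tx$. The $t$-harmonic product $\overset{t}{\ast}$ on $\mathfrak{h}_t^1$ is the $\mathbb{Q}[t]$-bilinear product with $1\overset{t}{\ast} w=w\overset{t}{\ast} 1=w$ and $z_kw_1\overset{t}{\ast} z_lw_2=z_k(w_1\overset{t}{\ast} z_lw_2)+z_l(z_kw_1\overset{t}{\ast} w_2)+(1-2t)z_{k+l}(w_1\overset{t}{\ast} w_2)+(1-\delta(w_1)\delta(w_2))(t^2-t)x^{k+l}(w_1\overset{t}{\ast} w_2)$ for words $w,w_1,w_2\in A^\ast\cap\mathfrak{h}_t^1$,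 $k,l\geqslant1$. -}

module Defs where

open import Data.Nat as ℕ using (ℕ; zero; suc; _∸_; _≡ᵇ_)
open import Data.Integer using (+_; -[1+_])
open import Data.Rational using (ℚ; _/_; 0ℚ; 1ℚ) renaming (_+_ to _+ℚ_; _*_ to _*ℚ_; -_ to -ℚ_)
open import Data.List using (List; []; _∷_; _++_; map; concat; concatMap; replicate; foldr)
open import Data.List.Properties using (≡-dec)
open import Data.Product using (_×_; _,_)
open import Data.Bool using (Bool; true; false; if_then_else_; _∧_; _∨_; not)
open import Relation.Nullary using (Dec; yes; no; does)
open import Relation.Binary.PropositionalEquality using (_≡_; refl)

data Letter : Set where
  x y : Letter

_≟L_ : (a b : Letter) → Dec (a ≡ b)
x ≟L x = yes refl
x ≟L y = no λ ()
y ≟L x = no λ ()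
y ≟L y = yes refl

Word : Set
Word = List Letter

_≟W_ : (u v : Word) → Dec (u ≡ v)
_≟W_ = ≡-dec _≟L_

z : ℕ → Word
z k = replicate (k ∸ 1) x ++ (y ∷ [])

Zw : List ℕ → Word
Zw ks = concatMap z ks

-- Elements of h_t = Q[t]<A> as finite formal sums of terms  c · t^m · w
Term : Set
Term = ℚ × ℕ × Word

Poly : Set
Poly = List Term

-- coefficient of t^m · w (the Q-basis of Q[t]<A> is {t^m w})
coeff : Poly → Word → ℕ → ℚ
coeff [] w m = 0ℚ
coeff ((c , e , u) ∷ p) w m =
  (if does (u ≟W w) ∧ (e ≡ᵇ m) then c else 0ℚ) +ℚ coeff p w m

infix 4 _≈_
_≈_ : Poly → Poly → Set
p ≈ q = ∀ (w : Word) (m : ℕ) → coeff p w m ≡ coeff q w m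

qℕ : ℕ → ℚ
qℕ n = (+ n) / 1

-1ℚ : ℚ
-1ℚ = -ℚ 1ℚ

mono : ℚ → ℕ → Word → Poly
mono c m w = (c , m , w) ∷ []

scale : ℚ → ℕ → Poly → Poly
scale c m = map (λ { (d , e , w) → (c *ℚ d , m ℕ.+ e , w) })

-- multiply by a polynomial in t given as a list of (coefficient, exponent)
scaleP : List (ℚ × ℕ) → Poly → Poly
scaleP f p = concatMap (λ { (c , m) → scale c m p }) f

pre : Word → Poly → Poly
pre u = map (λ { (c , e , w) → (c , e , u ++ w) })

neg : Poly → Poly
neg = scale -1ℚ 0

isEmpty : Word → Bool
isEmpty [] = true
isEmpty (_ ∷ _) = false

-- δ(w) ρ(a) v, with ρ(x) = 0, ρ(y) = t x
δρ : Word → Letter → Word → Poly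
δρ [] y v = mono 1ℚ 1 (x ∷ v)
δρ _ _ _ = []

tsh : Word → Word → Poly
tsh [] v = mono 1ℚ 0 v
tsh (a ∷ u) [] = mono 1ℚ 0 (a ∷ u)
tsh (a ∷ u) (b ∷ v) =
  pre (a ∷ []) (tsh u (b ∷ v))
  ++ pre (b ∷ []) (tsh (a ∷ u) v)
  ++ neg (δρ u a (b ∷ v))
  ++ neg (δρ v b (a ∷ u))

oneMinus2t : List (ℚ × ℕ)
oneMinus2t = (1ℚ , 0) ∷ (-ℚ qℕ 2 , 1) ∷ []

t²-t : List (ℚ × ℕ)
t²-t = (1ℚ , 2) ∷ (-1ℚ , 1) ∷ []

isNil : List ℕ → Bool
isNil [] = true
isNil (_ ∷ _) = false

-- t-harmonic product of two words of h_t^1, each given by its (unique)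
-- decomposition z_{k_1}...z_{k_m} as the index list [k_1,...,k_m]
harm : List ℕ → List ℕ → Poly
harm [] v = mono 1ℚ 0 (Zw v)
harm (k ∷ u) [] = mono 1ℚ 0 (Zw (k ∷ u))
harm (k ∷ u) (l ∷ v) =
  pre (z k) (harm u (l ∷ v))
  ++ pre (z l) (harm (k ∷ u) v)
  ++ scaleP oneMinus2t (pre (z (k ℕ.+ l)) (harm u v))
  ++ (if isNil u ∧ isNil v then []
      else scaleP t²-t (pre (replicate (k ℕ.+ l) x) (harm u v)))

-- [a, a+1, ..., b]  (empty if a > b)
range : ℕ → ℕ → List ℕ
range a b = go a (suc b ∸ a)
  where
  go : ℕ → ℕ → List ℕ
  go s zero = []
  go s (suc r) = s ∷ go (suc s) r

Zs : (ℕ → ℕ) → ℕ → ℕ → Word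
Zs k a b = Zw (map k (range a b))

δℕ : ℕ → ℕ → ℕ
δℕ i j = if i ≡ᵇ j then 1 else 0

shuffleRHS : ℕ → (ℕ → ℕ) → Poly
shuffleRHS n k =
  concatMap (λ i → mono 1ℚ 0 (Zs k 1 i ++ z 1 ++ Zs k (suc i) n)) (range 0 n)
  ++ concatMap (λ i → concatMap (λ j →
        mono 1ℚ 0 (Zs k 1 (i ∸ 1) ++ z j ++ z (k i ℕ.+ 1 ∸ j) ++ Zs k (suc i) n))
        (range 2 (k i))) (range 1 n)
  ++ concatMap (λ i →
        mono (-ℚ qℕ (k i ℕ.+ δℕ n i)) 1 (Zs k 1 (i ∸ 1) ++ z (k i ℕ.+ 1) ++ Zs k (suc i) n))
        (range 1 n)

harmonicRHS : ℕ → (ℕ → ℕ) → Poly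
harmonicRHS n k =
  concatMap (λ i → mono 1ℚ 0 (Zs k 1 i ++ z 1 ++ Zs k (suc i) n)) (range 0 n)
  ++ scaleP oneMinus2t (concatMap (λ i →
        mono 1ℚ 0 (Zs k 1 (i ∸ 1) ++ z (k i ℕ.+ 1) ++ Zs k (suc i) n)) (range 1 n))
  ++ scaleP t²-t (concatMap (λ i →
        mono 1ℚ 0 (Zs k 1 (i ∸ 1) ++ z (k i ℕ.+ k (suc i) ℕ.+ 1) ++ Zs k (suc (suc i)) n))
        (range 1 (n ∸ 1)))

module Submission where

-- Both identities follow by induction on n, splitting off the first block z_{k_1}.
-- On the left, unfolding the recursive definitions of the two products gives
--   y ш z_k w = Σ_{j=1}^{k} z_j z_{k+1-j} w - (k + δ(w)) t z_{k+1} w + z_k (y ш w),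
-- by induction on k: every x of z_k = x^{k-1} y contributes one more
-- deconcatenation term and one more -t x(...) term; and
--   y * z_k w = z_1 z_k w + (1 - 2t) z_{k+1} w + (t² - t) z_{k+k'+1} w' + z_k (y * w)
-- for w = z_{k'} w' (the last term being absent when w = 1).  On the right, the
-- summands with i = 1 are exactly these head terms, and all other summands are
-- z_{k_1} times the right-hand side for (k_2, ..., k_n).  Both sides are compared
-- coefficientwise, so reordering and merging summands costs nothing.

open import Defs
open import Algebra.Bundles using (CommutativeMonoid)
import Algebra.Properties.CommutativeSemigroup as CommutativeSemigroupProperties
import Algebra.Solver.CommutativeMonoid as CommutativeMonoidSolver
open import Data.Bool using (true; false; if_then_else_; _∧_)
open import Data.Integer as ℤ using (+_)
import Data.Integer.Properties as ℤ
open import Data.List using (List; []; _∷_; _++_; [_]; map; concatMap; replicate)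
import Data.List.Properties as List
open import Data.List.Relation.Unary.All using (All; []; _∷_)
open import Data.Nat using (ℕ; zero; suc; pred; _+_; _∸_; _≡ᵇ_; _≤_; z≤n; s≤s)
import Data.Nat.Coprimality as Coprimality
import Data.Nat.Properties as ℕ
open import Data.Product using (_×_; _,_)
open import Data.Rational using (ℚ; 0ℚ; 1ℚ; mkℚ) renaming (_+_ to _+ℚ_; -_ to -ℚ_)
import Data.Rational.Properties as ℚ
open import Function using (_∘_)
open import Level using (0ℓ)
open import Relation.Binary.PropositionalEquality
  using (_≡_; _≢_; refl; sym; trans; cong; cong₂; subst; module ≡-Reasoning)
import Relation.Binary.Reasoning.Setoid as SetoidReasoning
open import Relation.Binary.Structures using (IsEquivalence)
open import Relation.Nullary using (does; yes; no)
open import Relation.Nullary.Decidable using (dec-true; dec-false)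

-- Polynomials up to equality of coefficients

termCoeff : Term → Word → ℕ → ℚ
termCoeff (c , e , u) w m = if does (u ≟W w) ∧ (e ≡ᵇ m) then c else 0ℚ

coeff-++ : ∀ p q w m → coeff (p ++ q) w m ≡ coeff p w m +ℚ coeff q w m
coeff-++ [] q w m = sym (ℚ.+-identityˡ (coeff q w m))
coeff-++ (t ∷ p) q w m =
  trans (cong (termCoeff t w m +ℚ_) (coeff-++ p q w m))
        (sym (ℚ.+-assoc (termCoeff t w m) (coeff p w m) (coeff q w m)))

-- A record rather than _≈_ itself, so that the compared polynomials can be
-- inferred from the type.
infix 4 _≋_
record _≋_ (p q : Poly) : Set where
  constructor ≈⇒≋
  field ≋⇒≈ : p ≈ q
open _≋_

≋-isEquivalence : IsEquivalence _≋_
≋-isEquivalence = record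
  { refl  = ≈⇒≋ λ _ _ → refl
  ; sym   = λ (≈⇒≋ p≈q) → ≈⇒≋ λ w m → sym (p≈q w m)
  ; trans = λ (≈⇒≋ p≈q) (≈⇒≋ q≈r) → ≈⇒≋ λ w m → trans (p≈q w m) (q≈r w m)
  }

open IsEquivalence ≋-isEquivalence
  using () renaming (refl to ≋-refl; trans to ≋-trans; reflexive to ≋-reflexive)

++-cong : ∀ {p p′ q q′} → p ≋ p′ → q ≋ q′ → p ++ q ≋ p′ ++ q′
++-cong {p} {p′} {q} {q′} (≈⇒≋ p≈p′) (≈⇒≋ q≈q′) = ≈⇒≋ λ w m → begin
  coeff (p ++ q) w m            ≡⟨ coeff-++ p q w m ⟩
  coeff p w m +ℚ coeff q w m    ≡⟨ cong₂ _+ℚ_ (p≈p′ w m) (q≈q′ w m) ⟩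
  coeff p′ w m +ℚ coeff q′ w m  ≡⟨ coeff-++ p′ q′ w m ⟨
  coeff (p′ ++ q′) w m          ∎
  where open ≡-Reasoning

++-congˡ : ∀ p {q q′} → q ≋ q′ → p ++ q ≋ p ++ q′
++-congˡ p = ++-cong (≋-refl {p})

++-congʳ : ∀ {p p′} q → p ≋ p′ → p ++ q ≋ p′ ++ q
++-congʳ q p≋p′ = ++-cong p≋p′ (≋-refl {q})

++-comm : ∀ p q → p ++ q ≋ q ++ p
++-comm p q = ≈⇒≋ λ w m → begin
  coeff (p ++ q) w m          ≡⟨ coeff-++ p q w m ⟩
  coeff p w m +ℚ coeff q w m  ≡⟨ ℚ.+-comm (coeff p w m) (coeff q w m) ⟩
  coeff q w m +ℚ coeff p w m  ≡⟨ coeff-++ q p w m ⟨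
  coeff (q ++ p) w m          ∎
  where open ≡-Reasoning

++-commutativeMonoid : CommutativeMonoid 0ℓ 0ℓ
++-commutativeMonoid = record
  { Carrier = Poly
  ; _≈_     = _≋_
  ; _∙_     = _++_
  ; ε       = []
  ; isCommutativeMonoid = record
    { isMonoid = record
      { isSemigroup = record
        { isMagma = record { isEquivalence = ≋-isEquivalence ; ∙-cong = ++-cong }
        ; assoc   = λ p q r → ≋-reflexive (List.++-assoc p q r)
        }
      ; identity = (λ _ → ≋-refl) , (λ p → ≋-reflexive (List.++-identityʳ p))
      }
    ; comm = ++-comm
    }
  }

module ≋-Reasoning = SetoidReasoning (CommutativeMonoid.setoid ++-commutativeMonoid)
open CommutativeSemigroupProperties (CommutativeMonoid.commutativeSemigroup ++-commutativeMonoid)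
  using (interchange; x∙yz≈xz∙y)
open CommutativeMonoidSolver ++-commutativeMonoid using (solve; _⊜_; _⊕_)

mono-+ : ∀ a b e w → mono a e w ++ mono b e w ≋ mono (a +ℚ b) e w
mono-+ a b e w = ≈⇒≋ λ w′ m → merge (does (w ≟W w′) ∧ (e ≡ᵇ m))
  where
  merge : ∀ hit → (if hit then a else 0ℚ) +ℚ ((if hit then b else 0ℚ) +ℚ 0ℚ)
                  ≡ (if hit then a +ℚ b else 0ℚ) +ℚ 0ℚ
  merge true  = trans (cong (a +ℚ_) (ℚ.+-identityʳ b)) (sym (ℚ.+-identityʳ (a +ℚ b)))
  merge false = refl

qℕ-suc : ∀ n → qℕ (suc n) ≡ 1ℚ +ℚ qℕ n
qℕ-suc n = begin
  qℕ (suc n)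
    ≡⟨ ℚ./-cong {p₁ = + suc n} (cong (ℤ._+_ (+ 1)) (sym (ℤ.*-identityʳ (+ n)))) refl ⟩
  1ℚ +ℚ mkℚ (+ n) 0 (Coprimality.sym (Coprimality.1-coprimeTo n))
    ≡⟨ cong (1ℚ +ℚ_) (ℚ.normalize-coprime {n} {0} (Coprimality.sym (Coprimality.1-coprimeTo n))) ⟨
  1ℚ +ℚ qℕ n
    ∎
  where open ≡-Reasoning

-qℕ+-1≡-qℕ-suc : ∀ n → -ℚ qℕ n +ℚ -1ℚ ≡ -ℚ qℕ (suc n)
-qℕ+-1≡-qℕ-suc n = begin
  -ℚ qℕ n +ℚ -1ℚ   ≡⟨ ℚ.neg-distrib-+ (qℕ n) 1ℚ ⟨
  -ℚ (qℕ n +ℚ 1ℚ)  ≡⟨ cong -ℚ_ (ℚ.+-comm (qℕ n) 1ℚ) ⟩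
  -ℚ (1ℚ +ℚ qℕ n)  ≡⟨ cong -ℚ_ (qℕ-suc n) ⟨
  -ℚ qℕ (suc n)    ∎
  where open ≡-Reasoning

coeff-pre-[] : ∀ a p m → coeff (pre [ a ] p) [] m ≡ 0ℚ
coeff-pre-[] a [] m = refl
coeff-pre-[] a (_ ∷ p) m = trans (ℚ.+-identityˡ _) (coeff-pre-[] a p m)

coeff-pre-≡ : ∀ a p w m → coeff (pre [ a ] p) (a ∷ w) m ≡ coeff p w m
coeff-pre-≡ a [] w m = refl
coeff-pre-≡ a (t ∷ p) w m rewrite dec-true (a ≟L a) refl =
  cong (termCoeff t w m +ℚ_) (coeff-pre-≡ a p w m)

coeff-pre-≢ : ∀ {a b} → a ≢ b → ∀ p w m → coeff (pre [ a ] p) (b ∷ w) m ≡ 0ℚ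
coeff-pre-≢ a≢b [] w m = refl
coeff-pre-≢ {a} {b} a≢b (_ ∷ p) w m rewrite dec-false (a ≟L b) a≢b =
  trans (ℚ.+-identityˡ _) (coeff-pre-≢ a≢b p w m)

pre-[a]-cong : ∀ a {p q} → p ≋ q → pre [ a ] p ≋ pre [ a ] q
pre-[a]-cong a {p} {q} (≈⇒≋ p≈q) = ≈⇒≋ coeffs
  where
  coeffs : pre [ a ] p ≈ pre [ a ] q
  coeffs [] m = trans (coeff-pre-[] a p m) (sym (coeff-pre-[] a q m))
  coeffs (b ∷ w) m with a ≟L b
  ... | yes refl = trans (coeff-pre-≡ a p w m) (trans (p≈q w m) (sym (coeff-pre-≡ a q w m)))
  ... | no a≢b   = trans (coeff-pre-≢ a≢b p w m) (sym (coeff-pre-≢ a≢b q w m))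

pre-[] : ∀ p → pre [] p ≡ p
pre-[] = List.map-id

pre-∷ : ∀ a u p → pre (a ∷ u) p ≡ pre [ a ] (pre u p)
pre-∷ a u = List.map-∘

pre-++ : ∀ u p q → pre u (p ++ q) ≡ pre u p ++ pre u q
pre-++ u = List.map-++ _

pre-cong : ∀ u {p q} → p ≋ q → pre u p ≋ pre u q
pre-cong [] {p} {q} p≋q = begin
  pre [] p  ≡⟨ pre-[] p ⟩
  p         ≈⟨ p≋q ⟩
  q         ≡⟨ pre-[] q ⟨
  pre [] q  ∎
  where open ≋-Reasoning
pre-cong (a ∷ u) {p} {q} p≋q = begin
  pre (a ∷ u) p        ≡⟨ pre-∷ a u p ⟩
  pre [ a ] (pre u p)  ≈⟨ pre-[a]-cong a (pre-cong u p≋q) ⟩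
  pre [ a ] (pre u q)  ≡⟨ pre-∷ a u q ⟨
  pre (a ∷ u) q        ∎
  where open ≋-Reasoning

++-pre-collect : ∀ u a b c p q r →
  (a ++ pre u p) ++ (b ++ pre u q) ++ (c ++ pre u r) ≋ (a ++ b ++ c) ++ pre u (p ++ q ++ r)
++-pre-collect u a b c p q r = begin
  (a ++ pre u p) ++ (b ++ pre u q) ++ (c ++ pre u r)
    ≈⟨ ++-congˡ (a ++ pre u p) (interchange b (pre u q) c (pre u r)) ⟩
  (a ++ pre u p) ++ (b ++ c) ++ (pre u q ++ pre u r)
    ≈⟨ interchange a (pre u p) (b ++ c) (pre u q ++ pre u r) ⟩
  (a ++ b ++ c) ++ pre u p ++ pre u q ++ pre u r
    ≡⟨ cong ((a ++ b ++ c) ++_) (trans (pre-++ u p (q ++ r)) (cong (pre u p ++_) (pre-++ u q r))) ⟨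
  (a ++ b ++ c) ++ pre u (p ++ q ++ r)
    ∎
  where open ≋-Reasoning

scaleP-pre : ∀ f u p → scaleP f (pre u p) ≡ pre u (scaleP f p)
scaleP-pre f u p = trans (List.concatMap-cong (λ _ → trans (sym (List.map-∘ p)) (List.map-∘ p)) f)
                         (sym (List.map-concatMap _ _ f))

scaleP-++ : ∀ f p q → scaleP f (p ++ q) ≋ scaleP f p ++ scaleP f q
scaleP-++ [] p q = ≋-refl
scaleP-++ ((c , m) ∷ f) p q = begin
  scale c m (p ++ q) ++ scaleP f (p ++ q)
    ≈⟨ ++-cong (≋-reflexive (List.map-++ _ p q)) (scaleP-++ f p q) ⟩
  (scale c m p ++ scale c m q) ++ (scaleP f p ++ scaleP f q)
    ≈⟨ interchange (scale c m p) (scale c m q) (scaleP f p) (scaleP f q) ⟩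
  (scale c m p ++ scaleP f p) ++ (scale c m q ++ scaleP f q)
    ∎
  where open ≋-Reasoning

scaleP-++-pre : ∀ f p u q → scaleP f (p ++ pre u q) ≋ scaleP f p ++ pre u (scaleP f q)
scaleP-++-pre f p u q = begin
  scaleP f (p ++ pre u q)            ≈⟨ scaleP-++ f p (pre u q) ⟩
  scaleP f p ++ scaleP f (pre u q)   ≡⟨ cong (scaleP f p ++_) (scaleP-pre f u q) ⟩
  scaleP f p ++ pre u (scaleP f q)   ∎
  where open ≋-Reasoning

-- Ranges of indices

-- Defs.range counts upwards with a local function that cannot be named from
-- outside; upFrom is the same function.
upFrom : ℕ → ℕ → List ℕ
upFrom s zero    = []
upFrom s (suc r) = s ∷ upFrom (suc s) r

range≡upFrom : ∀ a b → range a b ≡ upFrom a (suc b ∸ a)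
range≡upFrom a b = counting (suc b ∸ a) refl
  where
  empty : ∀ {s} → suc b ∸ s ≡ 0 → range s b ≡ []
  empty eq rewrite eq = refl

  step : ∀ {s r} → suc b ∸ s ≡ suc r → b ∸ s ≡ r → range s b ≡ s ∷ range (suc s) b
  step eq eq′ rewrite eq | eq′ = refl

  counting : ∀ r {s} → suc b ∸ s ≡ r → range s b ≡ upFrom s r
  counting zero    eq = empty eq
  counting (suc r) {s} eq = trans (step eq eq′) (cong (s ∷_) (counting r eq′))
    where
    eq′ : b ∸ s ≡ r
    eq′ = trans (sym (ℕ.pred[m∸n]≡m∸[1+n] (suc b) s)) (cong pred eq)

upFrom-suc : ∀ s r → upFrom (suc s) r ≡ map suc (upFrom s r)
upFrom-suc s zero    = refl
upFrom-suc s (suc r) = cong (suc s ∷_) (upFrom-suc (suc s) r)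

range-suc : ∀ a b → range (suc a) (suc b) ≡ map suc (range a b)
range-suc a b = trans (range≡upFrom (suc a) (suc b))
  (trans (upFrom-suc a (suc b ∸ a)) (cong (map suc) (sym (range≡upFrom a b))))

map-range-1-suc : ∀ (k : ℕ → ℕ) n → map k (range 1 (suc n)) ≡ k 1 ∷ map (k ∘ suc) (range 1 n)
map-range-1-suc k n = cong (k 1 ∷_) (trans (cong (map k) (range-suc 1 n)) (sym (List.map-∘ (range 1 n))))

All-map-range : ∀ {P : ℕ → Set} n (k : ℕ → ℕ) →
  (∀ i → 1 ≤ i → i ≤ n → P (k i)) → All P (map k (range 1 n))
All-map-range zero    k Pk = []
All-map-range {P} (suc n) k Pk = subst (All P) (sym (map-range-1-suc k n))
  (Pk 1 (s≤s z≤n) (s≤s z≤n)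
    ∷ All-map-range n (k ∘ suc) λ i _ i≤n → Pk (suc i) (s≤s z≤n) (s≤s i≤n))

concatMap-pre : ∀ {u} {f g : ℕ → Poly} js → (∀ j → f j ≡ pre u (g j)) →
  concatMap f js ≡ pre u (concatMap g js)
concatMap-pre js fg = trans (List.concatMap-cong fg js) (sym (List.map-concatMap _ _ js))

concatMap-upFrom-suc : ∀ {u} {f g : ℕ → Poly} s r → (∀ i → s ≤ i → f (suc i) ≡ pre u (g i)) →
  concatMap f (upFrom (suc s) r) ≡ pre u (concatMap g (upFrom s r))
concatMap-upFrom-suc s zero fg = refl
concatMap-upFrom-suc {u} {f} {g} s (suc r) fg =
  trans (cong₂ _++_ (fg s ℕ.≤-refl) (concatMap-upFrom-suc (suc s) r λ i s<i → fg i (ℕ.<⇒≤ s<i)))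
        (sym (pre-++ u (g s) (concatMap g (upFrom (suc s) r))))

concatMap-range-suc : ∀ {u} (f g : ℕ → Poly) a b → (∀ i → a ≤ i → f (suc i) ≡ pre u (g i)) →
  concatMap f (range (suc a) (suc b)) ≡ pre u (concatMap g (range a b))
concatMap-range-suc {u} f g a b fg = begin
  concatMap f (range (suc a) (suc b))         ≡⟨ cong (concatMap f) (range≡upFrom (suc a) (suc b)) ⟩
  concatMap f (upFrom (suc a) (suc b ∸ a))    ≡⟨ concatMap-upFrom-suc a (suc b ∸ a) fg ⟩
  pre u (concatMap g (upFrom a (suc b ∸ a)))  ≡⟨ cong (pre u ∘ concatMap g) (range≡upFrom a b) ⟨
  pre u (concatMap g (range a b))             ∎
  where open ≡-Reasoning

Zs-shift : ∀ k a b → Zs k (suc a) (suc b) ≡ Zs (k ∘ suc) a b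
Zs-shift k a b = cong Zw (trans (cong (map k) (range-suc a b)) (sym (List.map-∘ (range a b))))

Zs-1-suc : ∀ k n → Zs k 1 (suc n) ≡ z (k 1) ++ Zs (k ∘ suc) 1 n
Zs-1-suc k n = cong Zw (map-range-1-suc k n)

Zs-split : ∀ k i a b (M : Word → Word) →
  Zs k 1 (suc i) ++ M (Zs k (suc a) (suc b)) ≡ z (k 1) ++ Zs (k ∘ suc) 1 i ++ M (Zs (k ∘ suc) a b)
Zs-split k i a b M = trans (cong₂ (λ P S → P ++ M S) (Zs-1-suc k i) (Zs-shift k a b))
                           (List.++-assoc (z (k 1)) (Zs (k ∘ suc) 1 i) _)

-- The t-shuffle product with y

δ : Word → ℕ
δ []      = 1
δ (_ ∷ _) = 0

δ-Zs : ∀ k n → δ (Zs k 1 n) ≡ δℕ n 0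
δ-Zs k zero    = refl
δ-Zs k (suc n) = trans (cong δ (Zs-1-suc k n)) (δ-z++ (k 1))
  where
  δ-z++ : ∀ l → δ (z l ++ Zs (k ∘ suc) 1 n) ≡ 0
  δ-z++ zero          = refl
  δ-z++ (suc zero)    = refl
  δ-z++ (suc (suc l)) = refl

splitZ : ℕ → Word → ℕ → Poly
splitZ k w j = mono 1ℚ 0 (z j ++ z (k + 1 ∸ j) ++ w)

shuffleHead : ℕ → ℕ → Word → Poly
shuffleHead k d w =
  mono 1ℚ 0 (z 1 ++ z k ++ w) ++ concatMap (splitZ k w) (range 2 k)
    ++ mono (-ℚ qℕ (k + d)) 1 (z (k + 1) ++ w)

x∷z : ∀ m → x ∷ z (suc m) ≡ z (suc m + 1)
x∷z m = cong z (ℕ.+-comm 1 (suc m))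

pre-x-splitZ : ∀ m w → pre [ x ] (concatMap (splitZ (suc m) w) (range 1 (suc m)))
                       ≡ concatMap (splitZ (suc (suc m)) w) (range 2 (suc (suc m)))
pre-x-splitZ m w =
  sym (concatMap-range-suc (splitZ (suc (suc m)) w) (splitZ (suc m) w) 1 (suc m) λ { (suc j) _ → refl })

y-tsh-x∷ : ∀ v →
  tsh [ y ] (x ∷ v) ≡ mono 1ℚ 0 (y ∷ x ∷ v) ++ pre [ x ] (tsh [ y ] v) ++ mono -1ℚ 1 (x ∷ x ∷ v)
y-tsh-x∷ []      = refl
y-tsh-x∷ (_ ∷ _) = refl

y-tsh-xᵐy++ : ∀ m w → tsh [ y ] (z (suc m) ++ w) ≋
  concatMap (splitZ (suc m) w) (range 1 (suc m)) ++ mono (-ℚ qℕ (suc m + δ w)) 1 (z (suc m + 1) ++ w)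
    ++ pre (z (suc m)) (tsh [ y ] w)
y-tsh-xᵐy++ zero [] = begin
  yy ++ pre [ y ] y¹ ++ txy ++ txy
    ≈⟨ ++-congˡ yy (++-comm (pre [ y ] y¹) (txy ++ txy)) ⟩
  yy ++ (txy ++ txy) ++ pre [ y ] y¹
    ≈⟨ ++-congˡ yy (++-congʳ (pre [ y ] y¹) (mono-+ -1ℚ -1ℚ 1 (x ∷ y ∷ []))) ⟩
  yy ++ mono (-1ℚ +ℚ -1ℚ) 1 (x ∷ y ∷ []) ++ pre [ y ] y¹
    ∎
  where
  open ≋-Reasoning
  y¹  = tsh [ y ] []
  yy  = mono 1ℚ 0 (y ∷ y ∷ [])
  txy = mono -1ℚ 1 (x ∷ y ∷ [])
y-tsh-xᵐy++ zero (a ∷ w) =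
  ++-congˡ (mono 1ℚ 0 (y ∷ y ∷ a ∷ w))
    (++-comm (pre [ y ] (tsh [ y ] (a ∷ w))) (mono -1ℚ 1 (x ∷ y ∷ a ∷ w)))
y-tsh-xᵐy++ (suc m) w = begin
  tsh [ y ] (x ∷ v)
    ≡⟨ y-tsh-x∷ v ⟩
  head ++ pre [ x ] (tsh [ y ] v) ++ last
    ≈⟨ ++-congˡ head (++-congʳ last (pre-[a]-cong x (y-tsh-xᵐy++ m w))) ⟩
  head ++ pre [ x ] (splits ++ raise ++ pre (z (suc m)) rest) ++ last
    ≡⟨ cong (λ p → head ++ p ++ last) pre-x-distrib ⟩
  head ++ (splits′ ++ raise′ ++ pre (z (suc (suc m))) rest) ++ last
    ≈⟨ regroup head splits′ raise′ (pre (z (suc (suc m))) rest) last ⟩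
  (head ++ splits′) ++ (raise′ ++ last) ++ pre (z (suc (suc m))) rest
    ≈⟨ ++-cong (≋-reflexive (cong (λ u → mono 1ℚ 0 (y ∷ u ++ w) ++ splits′) (x∷z m)))
               (++-congʳ (pre (z (suc (suc m))) rest) merge-raises) ⟩
  concatMap (splitZ (suc (suc m)) w) (range 1 (suc (suc m)))
    ++ mono (-ℚ qℕ (suc (suc m) + δ w)) 1 (z (suc (suc m) + 1) ++ w) ++ pre (z (suc (suc m))) rest
    ∎
  where
  open ≋-Reasoning
  v       = z (suc m) ++ w
  rest    = tsh [ y ] w
  head    = mono 1ℚ 0 (y ∷ x ∷ v)
  last    = mono -1ℚ 1 (x ∷ x ∷ v)
  splits  = concatMap (splitZ (suc m) w) (range 1 (suc m))
  raise   = mono (-ℚ qℕ (suc m + δ w)) 1 (z (suc m + 1) ++ w)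
  splits′ = concatMap (splitZ (suc (suc m)) w) (range 2 (suc (suc m)))
  raise′  = mono (-ℚ qℕ (suc m + δ w)) 1 (z (suc (suc m) + 1) ++ w)

  pre-x-distrib : pre [ x ] (splits ++ raise ++ pre (z (suc m)) rest)
                  ≡ splits′ ++ raise′ ++ pre (z (suc (suc m))) rest
  pre-x-distrib = trans (pre-++ [ x ] splits _) (cong₂ _++_ (pre-x-splitZ m w)
    (trans (pre-++ [ x ] raise _) (cong (raise′ ++_) (sym (pre-∷ x (z (suc m)) rest)))))

  regroup : ∀ a b c d e → a ++ (b ++ c ++ d) ++ e ≋ (a ++ b) ++ (c ++ e) ++ d
  regroup = solve 5 (λ a b c d e → a ⊕ ((b ⊕ (c ⊕ d)) ⊕ e) ⊜ (a ⊕ b) ⊕ ((c ⊕ e) ⊕ d)) ≋-refl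

  merge-raises : raise′ ++ last ≋ mono (-ℚ qℕ (suc (suc m) + δ w)) 1 (z (suc (suc m) + 1) ++ w)
  merge-raises = begin
    raise′ ++ last
      ≡⟨ cong (λ u → raise′ ++ mono -1ℚ 1 (x ∷ u ++ w)) (x∷z m) ⟩
    raise′ ++ mono -1ℚ 1 (z (suc (suc m) + 1) ++ w)
      ≈⟨ mono-+ _ -1ℚ 1 _ ⟩
    mono (-ℚ qℕ (suc m + δ w) +ℚ -1ℚ) 1 (z (suc (suc m) + 1) ++ w)
      ≡⟨ cong (λ c → mono c 1 (z (suc (suc m) + 1) ++ w)) (-qℕ+-1≡-qℕ-suc (suc m + δ w)) ⟩
    mono (-ℚ qℕ (suc (suc m) + δ w)) 1 (z (suc (suc m) + 1) ++ w)
      ∎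

y-tsh-z++ : ∀ {k} → 1 ≤ k → ∀ w →
  tsh [ y ] (z k ++ w) ≋ shuffleHead k (δ w) w ++ pre (z k) (tsh [ y ] w)
y-tsh-z++ {suc m} _ w = begin
  tsh [ y ] (z (suc m) ++ w)
    ≈⟨ y-tsh-xᵐy++ m w ⟩
  splitZ (suc m) w 1 ++ splits ++ raise ++ rest
    ≡⟨ cong (λ u → mono 1ℚ 0 (z 1 ++ z u ++ w) ++ splits ++ raise ++ rest) (ℕ.m+n∸n≡m (suc m) 1) ⟩
  mono 1ℚ 0 (z 1 ++ z (suc m) ++ w) ++ splits ++ raise ++ rest
    ≡⟨ cong (mono 1ℚ 0 (z 1 ++ z (suc m) ++ w) ++_) (List.++-assoc splits raise rest) ⟨
  mono 1ℚ 0 (z 1 ++ z (suc m) ++ w) ++ (splits ++ raise) ++ rest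
    ∎
  where
  open ≋-Reasoning
  splits = concatMap (splitZ (suc m) w) (range 2 (suc m))
  raise  = mono (-ℚ qℕ (suc m + δ w)) 1 (z (suc m + 1) ++ w)
  rest   = pre (z (suc m)) (tsh [ y ] w)

-- The t-harmonic product with z_1

mergeTerm : ℕ → List ℕ → Poly
mergeTerm k []      = []
mergeTerm k (l ∷ L) = scaleP t²-t (mono 1ℚ 0 (z (k + l + 1) ++ Zw L))

harmonicHead : ℕ → List ℕ → Poly
harmonicHead k L =
  mono 1ℚ 0 (z 1 ++ z k ++ Zw L) ++ scaleP oneMinus2t (mono 1ℚ 0 (z (k + 1) ++ Zw L)) ++ mergeTerm k L

replicate-x++z : ∀ r k → replicate r x ++ z (suc k) ≡ z (suc (r + k))
replicate-x++z zero    k = refl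
replicate-x++z (suc r) k = cong (x ∷_) (replicate-x++z r k)

replicate-x++z++ : ∀ l k w → replicate (suc l) x ++ z (suc k) ++ w ≡ z (l + suc k + 1) ++ w
replicate-x++z++ l k w = begin
  replicate (suc l) x ++ z (suc k) ++ w    ≡⟨ List.++-assoc (replicate (suc l) x) (z (suc k)) w ⟨
  (replicate (suc l) x ++ z (suc k)) ++ w  ≡⟨ cong (_++ w) (replicate-x++z (suc l) k) ⟩
  z (suc (suc l + k)) ++ w                 ≡⟨ cong (λ n → z n ++ w) index ⟩
  z (l + suc k + 1) ++ w                   ∎
  where
  open ≡-Reasoning
  index : suc (suc l + k) ≡ l + suc k + 1
  index = sym (trans (ℕ.+-comm (l + suc k) 1) (cong suc (ℕ.+-suc l k)))

harm-z₁-∷ : ∀ l L → All (1 ≤_) L →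
  harm [ 1 ] (l ∷ L) ≋ harmonicHead l L ++ pre (z l) (harm [ 1 ] L)
harm-z₁-∷ l L pos = begin
  a ++ rest ++ b ++ merged  ≈⟨ x∙yz≈xz∙y a rest (b ++ merged) ⟩
  (a ++ b ++ merged) ++ rest
    ≡⟨ cong (λ n → (a ++ scaleP oneMinus2t (mono 1ℚ 0 (z n ++ Zw L)) ++ merged) ++ rest)
            (ℕ.+-comm 1 l) ⟩
  (a ++ b′ ++ merged) ++ rest
    ≡⟨ cong (λ p → (a ++ b′ ++ p) ++ rest) (merged≡mergeTerm L pos) ⟩
  harmonicHead l L ++ rest
    ∎
  where
  open ≋-Reasoning
  a    = mono 1ℚ 0 (z 1 ++ z l ++ Zw L)
  b    = scaleP oneMinus2t (mono 1ℚ 0 (z (suc l) ++ Zw L))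
  b′   = scaleP oneMinus2t (mono 1ℚ 0 (z (l + 1) ++ Zw L))
  rest = pre (z l) (harm [ 1 ] L)
  merged = if isNil L then [] else scaleP t²-t (mono 1ℚ 0 (replicate (suc l) x ++ Zw L))

  merged≡mergeTerm : ∀ M → All (1 ≤_) M →
    (if isNil M then [] else scaleP t²-t (mono 1ℚ 0 (replicate (suc l) x ++ Zw M))) ≡ mergeTerm l M
  merged≡mergeTerm []          _ = refl
  merged≡mergeTerm (zero ∷ M)  (() ∷ _)
  merged≡mergeTerm (suc k ∷ M) _ =
    cong (λ u → scaleP t²-t (mono 1ℚ 0 u)) (replicate-x++z++ l k (Zw M))

-- The right-hand sides, summand by summand

-- shuffleRHS n k and harmonicRHS n k unfold definitionally into sums over i of
-- the following summands.
insertion : (ℕ → ℕ) → ℕ → ℕ → Poly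
insertion k n i = mono 1ℚ 0 (Zs k 1 i ++ z 1 ++ Zs k (suc i) n)

splitting : (ℕ → ℕ) → ℕ → ℕ → Poly
splitting k n i =
  concatMap (λ j → mono 1ℚ 0 (Zs k 1 (i ∸ 1) ++ z j ++ z (k i + 1 ∸ j) ++ Zs k (suc i) n)) (range 2 (k i))

raising : (ℕ → ℚ) → ℕ → (ℕ → ℕ) → ℕ → ℕ → Poly
raising c e k n i = mono (c i) e (Zs k 1 (i ∸ 1) ++ z (k i + 1) ++ Zs k (suc i) n)

merging : (ℕ → ℕ) → ℕ → ℕ → Poly
merging k n i = mono 1ℚ 0 (Zs k 1 (i ∸ 1) ++ z (k i + k (suc i) + 1) ++ Zs k (suc (suc i)) n)

insertions : ℕ → (ℕ → ℕ) → Poly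
insertions n k = concatMap (insertion k n) (range 0 n)

splittings : ℕ → (ℕ → ℕ) → Poly
splittings n k = concatMap (splitting k n) (range 1 n)

raisings : (ℕ → ℚ) → ℕ → ℕ → (ℕ → ℕ) → Poly
raisings c e n k = concatMap (raising c e k n) (range 1 n)

merges : ℕ → (ℕ → ℕ) → Poly
merges n k = concatMap (merging k n) (range 1 (n ∸ 1))

insertions-suc : ∀ n k →
  insertions (suc n) k
    ≡ mono 1ℚ 0 (z 1 ++ z (k 1) ++ Zs (k ∘ suc) 1 n) ++ pre (z (k 1)) (insertions n (k ∘ suc))
insertions-suc n k = cong₂ _++_ (cong (λ w → mono 1ℚ 0 (z 1 ++ w)) (Zs-1-suc k n))
  (concatMap-range-suc (insertion k (suc n)) (insertion (k ∘ suc) n) 0 n λ i _ →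
    cong (mono 1ℚ 0) (Zs-split k i (suc i) n (z 1 ++_)))

splittings-suc : ∀ n k → splittings (suc n) k
  ≡ concatMap (splitZ (k 1) (Zs (k ∘ suc) 1 n)) (range 2 (k 1)) ++ pre (z (k 1)) (splittings n (k ∘ suc))
splittings-suc n k = cong₂ _++_ (cong (λ w → concatMap (splitZ (k 1) w) (range 2 (k 1))) (Zs-shift k 1 n))
  (concatMap-range-suc (splitting k (suc n)) (splitting (k ∘ suc) n) 1 n λ { (suc i) _ →
    concatMap-pre (range 2 (k (suc (suc i)))) λ j → cong (mono 1ℚ 0)
      (Zs-split k i (suc (suc i)) n (λ w → z j ++ z (k (suc (suc i)) + 1 ∸ j) ++ w)) })

raisings-suc : ∀ c e n k → raisings c e (suc n) k
  ≡ mono (c 1) e (z (k 1 + 1) ++ Zs (k ∘ suc) 1 n) ++ pre (z (k 1)) (raisings (c ∘ suc) e n (k ∘ suc))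
raisings-suc c e n k = cong₂ _++_ (cong (λ w → mono (c 1) e (z (k 1 + 1) ++ w)) (Zs-shift k 1 n))
  (concatMap-range-suc (raising c e k (suc n)) (raising (c ∘ suc) e (k ∘ suc) n) 1 n λ { (suc i) _ →
    cong (mono (c (suc (suc i))) e) (Zs-split k i (suc (suc i)) n (z (k (suc (suc i)) + 1) ++_)) })

merges-suc : ∀ n k → merges (suc (suc n)) k
  ≡ mono 1ℚ 0 (z (k 1 + k 2 + 1) ++ Zs (k ∘ suc ∘ suc) 1 n) ++ pre (z (k 1)) (merges (suc n) (k ∘ suc))
merges-suc n k =
  cong₂ _++_ (cong (λ w → mono 1ℚ 0 (z (k 1 + k 2 + 1) ++ w))
                   (trans (Zs-shift k 2 (suc n)) (Zs-shift (k ∘ suc) 1 n)))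
    (concatMap-range-suc (merging k (suc (suc n))) (merging (k ∘ suc) (suc n)) 1 n λ { (suc i) _ →
      cong (mono 1ℚ 0)
        (Zs-split k i (suc (suc (suc i))) (suc n) (z (k (suc (suc i)) + k (suc (suc (suc i))) + 1) ++_)) })

scaled-merges-suc : ∀ n k → scaleP t²-t (merges (suc n) k)
  ≋ mergeTerm (k 1) (map (k ∘ suc) (range 1 n)) ++ pre (z (k 1)) (scaleP t²-t (merges n (k ∘ suc)))
scaled-merges-suc zero    k = ≋-refl
scaled-merges-suc (suc n) k = begin
  scaleP t²-t (merges (suc (suc n)) k)
    ≡⟨ cong (scaleP t²-t) (merges-suc n k) ⟩
  scaleP t²-t (first ++ pre (z (k 1)) (merges (suc n) (k ∘ suc)))
    ≈⟨ scaleP-++-pre t²-t first (z (k 1)) (merges (suc n) (k ∘ suc)) ⟩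
  scaleP t²-t first ++ pre (z (k 1)) (scaleP t²-t (merges (suc n) (k ∘ suc)))
    ≡⟨ cong (λ L → mergeTerm (k 1) L ++ pre (z (k 1)) (scaleP t²-t (merges (suc n) (k ∘ suc))))
            (map-range-1-suc (k ∘ suc) n) ⟨
  mergeTerm (k 1) (map (k ∘ suc) (range 1 (suc n)))
    ++ pre (z (k 1)) (scaleP t²-t (merges (suc n) (k ∘ suc)))
    ∎
  where
  open ≋-Reasoning
  first = mono 1ℚ 0 (z (k 1 + k 2 + 1) ++ Zs (k ∘ suc ∘ suc) 1 n)

shuffleRHS-suc : ∀ n k →
  shuffleRHS (suc n) k
    ≋ shuffleHead (k 1) (δℕ n 0) (Zs (k ∘ suc) 1 n) ++ pre (z (k 1)) (shuffleRHS n (k ∘ suc))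
shuffleRHS-suc n k = begin
  insertions (suc n) k ++ splittings (suc n) k ++ raisings weight 1 (suc n) k
    ≡⟨ cong₂ _++_ (insertions-suc n k) (cong₂ _++_ (splittings-suc n k) (raisings-suc weight 1 n k)) ⟩
  (first ++ pre u (insertions n k′)) ++ (splits ++ pre u (splittings n k′))
    ++ (raise ++ pre u (raisings (weight ∘ suc) 1 n k′))
    ≈⟨ ++-pre-collect u first splits raise
         (insertions n k′) (splittings n k′) (raisings (weight ∘ suc) 1 n k′) ⟩
  shuffleHead (k 1) (δℕ n 0) w ++ pre u (shuffleRHS n k′)
    ∎
  where
  open ≋-Reasoning
  k′     = k ∘ suc
  u      = z (k 1)
  w      = Zs k′ 1 n
  weight = λ i → -ℚ qℕ (k i + δℕ (suc n) i)
  first  = mono 1ℚ 0 (z 1 ++ z (k 1) ++ w)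
  splits = concatMap (splitZ (k 1) w) (range 2 (k 1))
  raise  = mono (weight 1) 1 (z (k 1 + 1) ++ w)

harmonicRHS-suc : ∀ n k → harmonicRHS (suc n) k
  ≋ harmonicHead (k 1) (map (k ∘ suc) (range 1 n)) ++ pre (z (k 1)) (harmonicRHS n (k ∘ suc))
harmonicRHS-suc n k = begin
  insertions (suc n) k ++ scaleP oneMinus2t (raisings one 0 (suc n) k) ++ scaleP t²-t (merges (suc n) k)
    ≈⟨ ++-cong (≋-reflexive (insertions-suc n k)) (++-cong raisings-part (scaled-merges-suc n k)) ⟩
  (first ++ pre u (insertions n k′)) ++ (raise ++ pre u (scaleP oneMinus2t (raisings one 0 n k′)))
    ++ (mergeTerm (k 1) L ++ pre u (scaleP t²-t (merges n k′)))
    ≈⟨ ++-pre-collect u first raise (mergeTerm (k 1) L)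
         (insertions n k′) (scaleP oneMinus2t (raisings one 0 n k′)) (scaleP t²-t (merges n k′)) ⟩
  harmonicHead (k 1) L ++ pre u (harmonicRHS n k′)
    ∎
  where
  open ≋-Reasoning
  k′    = k ∘ suc
  u     = z (k 1)
  L     = map k′ (range 1 n)
  one   = λ (_ : ℕ) → 1ℚ
  first = mono 1ℚ 0 (z 1 ++ z (k 1) ++ Zw L)
  raise = scaleP oneMinus2t (mono 1ℚ 0 (z (k 1 + 1) ++ Zw L))

  raisings-part : scaleP oneMinus2t (raisings one 0 (suc n) k)
                  ≋ raise ++ pre u (scaleP oneMinus2t (raisings one 0 n k′))
  raisings-part = begin
    scaleP oneMinus2t (raisings one 0 (suc n) k)
      ≡⟨ cong (scaleP oneMinus2t) (raisings-suc one 0 n k) ⟩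
    scaleP oneMinus2t (mono 1ℚ 0 (z (k 1 + 1) ++ Zw L) ++ pre u (raisings one 0 n k′))
      ≈⟨ scaleP-++-pre oneMinus2t (mono 1ℚ 0 (z (k 1 + 1) ++ Zw L)) u (raisings one 0 n k′) ⟩
    raise ++ pre u (scaleP oneMinus2t (raisings one 0 n k′))
      ∎

shuffle-formula : ∀ n k → All (1 ≤_) (map k (range 1 n)) →
  tsh [ y ] (Zs k 1 n) ≋ shuffleRHS n k
shuffle-formula zero    k _ = ≋-refl
shuffle-formula (suc n) k pos with subst (All (1 ≤_)) (map-range-1-suc k n) pos
... | k₁-pos ∷ pos′ = begin
  tsh [ y ] (Zs k 1 (suc n))
    ≡⟨ cong (tsh [ y ]) (Zs-1-suc k n) ⟩
  tsh [ y ] (z (k 1) ++ w)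
    ≈⟨ y-tsh-z++ k₁-pos w ⟩
  shuffleHead (k 1) (δ w) w ++ pre (z (k 1)) (tsh [ y ] w)
    ≈⟨ ++-cong (≋-reflexive (cong (λ d → shuffleHead (k 1) d w) (δ-Zs (k ∘ suc) n)))
               (pre-cong (z (k 1)) (shuffle-formula n (k ∘ suc) pos′)) ⟩
  shuffleHead (k 1) (δℕ n 0) w ++ pre (z (k 1)) (shuffleRHS n (k ∘ suc))
    ≈⟨ shuffleRHS-suc n k ⟨
  shuffleRHS (suc n) k
    ∎
  where
  open ≋-Reasoning
  w = Zs (k ∘ suc) 1 n

harmonic-formula : ∀ n k → All (1 ≤_) (map k (range 1 n)) →
  harm [ 1 ] (map k (range 1 n)) ≋ harmonicRHS n k
harmonic-formula zero    k _ = ≋-refl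
harmonic-formula (suc n) k pos with subst (All (1 ≤_)) (map-range-1-suc k n) pos
... | _ ∷ pos′ = begin
  harm [ 1 ] (map k (range 1 (suc n)))
    ≡⟨ cong (harm [ 1 ]) (map-range-1-suc k n) ⟩
  harm [ 1 ] (k 1 ∷ L)
    ≈⟨ harm-z₁-∷ (k 1) L pos′ ⟩
  harmonicHead (k 1) L ++ pre (z (k 1)) (harm [ 1 ] L)
    ≈⟨ ++-congˡ (harmonicHead (k 1) L) (pre-cong (z (k 1)) (harmonic-formula n (k ∘ suc) pos′)) ⟩
  harmonicHead (k 1) L ++ pre (z (k 1)) (harmonicRHS n (k ∘ suc))
    ≈⟨ harmonicRHS-suc n k ⟨
  harmonicRHS (suc n) k
    ∎
  where
  open ≋-Reasoning
  L = map (k ∘ suc) (range 1 n)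

lemma2p10 : (n : ℕ) → 1 ≤ n → (k : ℕ → ℕ) → (∀ i → 1 ≤ i → i ≤ n → 1 ≤ k i) →
    (tsh (y ∷ []) (Zs k 1 n) ≈ shuffleRHS n k)
    × (harm (1 ∷ []) (map k (range 1 n)) ≈ harmonicRHS n k)
lemma2p10 n _ k k-pos = ≋⇒≈ (shuffle-formula n k pos) , ≋⇒≈ (harmonic-formula n k pos)
  where
  pos : All (1 ≤_) (map k (range 1 n))
  pos = All-map-range n k k-pos
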